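{- Let $n\ge1$ and let $k_1\le k_2\le\dots\le k_n$ be a weakly increasing sequence of integers. Then $\alpha(n;k_1,\dots,k_n)$ equals the number of Gelfand–Tsetlin patterns $(a_{i,j})_{1\le j\le i\le n}$ with bottom row $(a_{n,1},\dots,a_{n,n})=(k_1,\dots,k_n)$ in which every row $i<n$ is strictly increasing, i.e. $a_{i,1}<a_{i,2}<\dots<a_{i,i}$ for $1\le i\le n-1$.
   Context: A Gelfand–Tsetlin pattern with $n$ rows is a triangular array of integers $(a_{i,j})_{1\le j\le i\le n}$ with $a_{i+1,j}\le a_{i,j}\le a_{i+1,j+1}$ for all $1\le j\le i<n$. A monotone triangle is a Gelfand–Tsetlin pattern all of whose rows (including the bottom row) are strictly increasing. For strictly increasing integers $k_1<\dots<k_n$, the number of monotone triangles with bottom row $(k_1,\dots,k_n)$ is given by a (unique) polynomial in $k_1,\dots,k_n$; $\alpha(n;k_1,\dots,k_n)$ denotes this polynomial, evaluated at arbitrary $(k_1,\dots,k_n)\in\mathbb Z^n$. -}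

module Defs where

open import Data.Nat as ℕ using (ℕ; zero; suc)
open import Data.Integer as ℤ using (ℤ; +_)
open import Data.Rational as ℚ using (ℚ)
open import Data.Fin as Fin using (Fin)
open import Data.Vec using (Vec; []; _∷_; lookup)
open import Data.List using (List; []; _∷_; map; concatMap; filter; upTo)
open import Data.Nat.ListAction using (sum)
open import Data.Bool using (Bool; true; false; _∧_)
open import Relation.Nullary.Decidable using (⌊_⌋)

data Poly (n : ℕ) : Set where
  const : ℚ → Poly n
  var   : Fin n → Poly n
  _⊕_   : Poly n → Poly n → Poly n
  _⊗_   : Poly n → Poly n → Poly n

eval : ∀ {n} → Poly n → Vec ℤ n → ℚ
eval (const q) k = q
eval (var i)   k = (lookup k i) ℚ./ 1
eval (p ⊕ q)   k = eval p k ℚ.+ eval q k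
eval (p ⊗ q)   k = eval p k ℚ.* eval q k

StrictlyIncreasing : ∀ {n} → Vec ℤ n → Set
StrictlyIncreasing {n} k = (i j : Fin n) → i Fin.< j → lookup k i ℤ.< lookup k j

WeaklyIncreasing : ∀ {n} → Vec ℤ n → Set
WeaklyIncreasing {n} k = (i j : Fin n) → i Fin.≤ j → lookup k i ℤ.≤ lookup k j

range : ℤ → ℤ → List ℤ
range x y with ⌊ x ℤ.≤? y ⌋
... | true  = map (λ i → x ℤ.+ + i) (upTo (suc ℤ.∣ y ℤ.- x ∣))
... | false = []

-- all rows s = (s₁,…,s_m) with r_j ≤ s_j ≤ r_{j+1}  (the row above r)
interlacing : ∀ {m} → Vec ℤ (suc m) → List (Vec ℤ m)
interlacing (x ∷ [])    = [] ∷ []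
interlacing (x ∷ y ∷ r) = concatMap (λ s → map (s ∷_) (interlacing (y ∷ r))) (range x y)

strictRow : ∀ {m} → Vec ℤ m → Bool
strictRow []          = true
strictRow (x ∷ [])    = true
strictRow (x ∷ y ∷ r) = ⌊ x ℤ.<? y ⌋ ∧ strictRow (y ∷ r)

-- Number of Gelfand–Tsetlin patterns with bottom row r (of length m+1)
-- in which every row other than the bottom row is strictly increasing.
countGTStrictAbove : ∀ {m} → Vec ℤ (suc m) → ℕ
countGTStrictAbove {zero}  r = 1
countGTStrictAbove {suc m} r =
  sum (map countGTStrictAbove (filter (λ s → strictRow s Data.Bool.≟ true) (interlacing r)))

-- Number of monotone triangles with bottom row k (meaningful for strictly
-- increasing k): a GT pattern all of whose rows are strictly increasing.
numMonotoneTriangles : ∀ {m} → Vec ℤ (suc m) → ℕ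
numMonotoneTriangles k = countGTStrictAbove k

IsAlpha : ∀ {m} → Poly (suc m) → Set
IsAlpha {m} P = (k : Vec ℤ (suc m)) → StrictlyIncreasing k →
                eval P k ≡ (+ numMonotoneTriangles k) ℚ./ 1
  where open import Relation.Binary.PropositionalEquality using (_≡_)

-- Let c(k) count the Gelfand–Tsetlin patterns with bottom row k whose higher rows are strictly
-- increasing, so that c(k) is the sum of c(l) over the strictly increasing rows l interlacing k.
-- Summing entry by entry and replacing each sum over an interval [x, y) by a difference of
-- antidifferences turns this recursion into a polynomial expression in k; iterating it gives a
-- polynomial P with P(k) = c(k) for all weakly increasing k. When two consecutive entries of k
-- coincide the expression also picks up rows with a repeated entry, but their contributions vanish
-- because c vanishes on rows with three equal consecutive entries. Finally α and P agree on strictly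
-- increasing k, and a polynomial vanishing at all strictly increasing points is zero (in each
-- variable it vanishes on a half-line), so α = P.

module Submission where

open import Defs
open import Data.Nat using (ℕ; suc)
open import Data.Integer using (ℤ; +_)
open import Data.Rational using (_/_)
open import Data.Vec using (Vec)
open import Relation.Binary.PropositionalEquality using (_≡_)

open import Data.Bool using (true; false; if_then_else_; _∧_)
import Data.Bool as Bool
import Data.Bool.Properties as Boolₚ
open import Data.Empty using (⊥)
open import Data.Fin as Fin using (Fin)
import Data.Integer as ℤ
open import Data.Integer using (-[1+_])
import Data.Integer.Properties as ℤₚ
open import Data.Integer.Solver using () renaming (module +-*-Solver to ℤ-Solver)
open import Data.List as List using (List; []; _∷_; _++_; applyUpTo; _∷ʳ_)
import Data.List.Properties as Listₚ
open import Data.List.Relation.Unary.All as All using (All; [])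
import Data.List.Relation.Unary.All.Properties as Allₚ
open import Data.Nat as ℕ using (zero; z≤n; s≤s; _⊔_)
open import Data.Nat.ListAction using (sum)
import Data.Nat.Properties as ℕₚ
open import Data.Product using (∃-syntax; _×_; _,_; proj₁; proj₂)
open import Data.Rational as ℚ using (ℚ; 0ℚ; 1ℚ; _+_; _-_; -_; _*_; fromℚᵘ; toℚᵘ)
import Data.Rational.Properties as ℚₚ
open import Algebra.Properties.Group ℚₚ.+-0-group using (x∙y⁻¹≈ε⇒x≈y)
open import Data.Rational.Solver using (module +-*-Solver)
open import Data.Rational.Unnormalised as ℚᵘ using (mkℚᵘ; *≡*)
import Data.Rational.Unnormalised.Properties as ℚᵘₚ
open import Data.Sum using (_⊎_; inj₁; inj₂)
open import Data.Unit using (⊤; tt)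
open import Data.Vec using ([]; _∷_; lookup; head; tail)
open import Data.Vec.Relation.Unary.Linked as Linked using (Linked; []; [-]; _∷_)
open import Data.Vec.Relation.Unary.Linked.Properties using (lookup⁺)
open import Function using (_∘_)
open import Relation.Binary.PropositionalEquality using (refl; sym; trans; cong; cong₂; subst; _≗_; module ≡-Reasoning)
open import Relation.Nullary using (Dec; yes; no; ¬_; contradiction)
open import Relation.Nullary.Decidable using (⌊_⌋; dec-true; dec-false; isYes≗does)

open ≡-Reasoning
open +-*-Solver using (solve; _:+_; _:-_; :-_; _:*_; _:=_; con)
open ℤ-Solver using () renaming (solve to ℤ-solve; _:+_ to _ℤ:+_; _:-_ to _ℤ:-_; _:*_ to _ℤ:*_; _:=_ to _ℤ:=_; con to ℤcon)

Δ : (ℤ → ℚ) → ℤ → ℚ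
Δ g x = g (ℤ.suc x) - g x

Degree≤ : ℕ → (ℤ → ℚ) → Set
Degree≤ zero    g = ∀ x → Δ g x ≡ 0ℚ
Degree≤ (suc d) g = Degree≤ d (Δ g)

Δ-cong : ∀ {g h} → g ≗ h → Δ g ≗ Δ h
Δ-cong g≗h x = cong₂ _-_ (g≗h (ℤ.suc x)) (g≗h x)

Δ-+ : ∀ f g → Δ (λ x → f x + g x) ≗ λ x → Δ f x + Δ g x
Δ-+ f g x = solve 4 (λ a b c d → (a :+ b) :- (c :+ d) := (a :- c) :+ (b :- d)) refl
  (f (ℤ.suc x)) (g (ℤ.suc x)) (f x) (g x)

Δ-neg : ∀ f → Δ (λ x → - f x) ≗ λ x → - Δ f x
Δ-neg f x = solve 2 (λ a b → (:- a) :- (:- b) := :- (a :- b)) refl (f (ℤ.suc x)) (f x)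

Δ-scale : ∀ c f → Δ (λ x → c * f x) ≗ λ x → c * Δ f x
Δ-scale c f x = solve 3 (λ c a b → c :* a :- c :* b := c :* (a :- b)) refl c (f (ℤ.suc x)) (f x)

Δ-diagonal : ∀ (F : ℤ → ℤ → ℚ) → Δ (λ y → F y y) ≗ λ y → Δ (λ u → F u (ℤ.suc y)) y + Δ (F y) y
Δ-diagonal F y = solve 3 (λ a b c → a :- c := (a :- b) :+ (b :- c)) refl
  (F (ℤ.suc y) (ℤ.suc y)) (F y (ℤ.suc y)) (F y y)

Degree≤-cong : ∀ d {g h} → g ≗ h → Degree≤ d g → Degree≤ d h
Degree≤-cong zero    g≗h p x = trans (sym (Δ-cong g≗h x)) (p x)
Degree≤-cong (suc d) g≗h p   = Degree≤-cong d (Δ-cong g≗h) p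

Degree≤-0 : ∀ d {g} → g ≗ (λ _ → 0ℚ) → Degree≤ d g
Degree≤-0 zero    g≗0 = Δ-cong g≗0
Degree≤-0 (suc d) g≗0 = Degree≤-0 d (Δ-cong g≗0)

Degree≤-const : ∀ d c → Degree≤ d (λ _ → c)
Degree≤-const zero    c x = ℚₚ.+-inverseʳ c
Degree≤-const (suc d) c   = Degree≤-0 d (λ _ → ℚₚ.+-inverseʳ c)

Degree≤-mono : ∀ {d e g} → d ℕ.≤ e → Degree≤ d g → Degree≤ e g
Degree≤-mono {e = zero}  z≤n       p = p
Degree≤-mono {e = suc e} z≤n       p = Degree≤-0 e p
Degree≤-mono             (s≤s d≤e) p = Degree≤-mono d≤e p

Degree≤-+ : ∀ d {f g} → Degree≤ d f → Degree≤ d g → Degree≤ d (λ x → f x + g x)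
Degree≤-+ zero    {f} {g} p q x = trans (Δ-+ f g x) (cong₂ _+_ (p x) (q x))
Degree≤-+ (suc d) {f} {g} p q   = Degree≤-cong d (sym ∘ Δ-+ f g) (Degree≤-+ d p q)

Degree≤-neg : ∀ d {f} → Degree≤ d f → Degree≤ d (λ x → - f x)
Degree≤-neg zero    {f} p x = trans (Δ-neg f x) (cong -_ (p x))
Degree≤-neg (suc d) {f} p   = Degree≤-cong d (sym ∘ Δ-neg f) (Degree≤-neg d p)

Degree≤-- : ∀ d {f g} → Degree≤ d f → Degree≤ d g → Degree≤ d (λ x → f x - g x)
Degree≤-- d p q = Degree≤-+ d p (Degree≤-neg d q)

Degree≤-scale : ∀ d c {f} → Degree≤ d f → Degree≤ d (λ x → c * f x)
Degree≤-scale zero    c {f} p x = trans (Δ-scale c f x) (trans (cong (c *_) (p x)) (ℚₚ.*-zeroʳ c))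
Degree≤-scale (suc d) c {f} p   = Degree≤-cong d (sym ∘ Δ-scale c f) (Degree≤-scale d c p)

Degree≤-shift : ∀ d {g} → Degree≤ d g → Degree≤ d (g ∘ ℤ.suc)
Degree≤-shift zero    p x = p (ℤ.suc x)
Degree≤-shift (suc d) p   = Degree≤-shift d p

Degree≤-Δ-other : ∀ a {F : ℤ → ℤ → ℚ} → (∀ v → Degree≤ a (λ u → F u v)) →
                  ∀ v → Degree≤ a (λ u → Δ (F u) v)
Degree≤-Δ-other a {F} pu v = Degree≤-- a {λ u → F u (ℤ.suc v)} {λ u → F u v} (pu (ℤ.suc v)) (pu v)

-- The two summands of Δ-diagonal have degrees (a - 1, b) and (a, b - 1) in (u, v).
Degree≤-diagonal : ∀ a b {F : ℤ → ℤ → ℚ} →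
                   (∀ v → Degree≤ a (λ u → F u v)) → (∀ u → Degree≤ b (F u)) →
                   Degree≤ (a ℕ.+ b) (λ y → F y y)
Degree≤-diagonal zero zero {F} pu pv y =
  trans (Δ-diagonal F y) (cong₂ _+_ (pu (ℤ.suc y) y) (pv y y))
Degree≤-diagonal zero (suc b) {F} pu pv =
  Degree≤-cong b (λ y → sym (trans (Δ-diagonal F y)
                               (trans (cong (_+ Δ (F y) y) (pu (ℤ.suc y) y)) (ℚₚ.+-identityˡ _))))
    (Degree≤-diagonal zero b {λ u → Δ (F u)} (Degree≤-Δ-other 0 {F} pu) pv)
Degree≤-diagonal (suc a) b {F} pu pv =
  Degree≤-cong (a ℕ.+ b) (sym ∘ Δ-diagonal F)
    (Degree≤-+ (a ℕ.+ b)
      (Degree≤-diagonal a b {λ u v → Δ (λ u′ → F u′ (ℤ.suc v)) u} (λ v → pu (ℤ.suc v))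
        (λ u → Degree≤-shift b (Degree≤-Δ-other b {λ v u′ → F u′ v} pv u)))
      (second-summand b pv))
  where
    second-summand : ∀ b → (∀ u → Degree≤ b (F u)) → Degree≤ (a ℕ.+ b) (λ y → Δ (F y) y)
    second-summand zero    pv = Degree≤-0 (a ℕ.+ 0) (λ y → pv y y)
    second-summand (suc b) pv = subst (λ e → Degree≤ e (λ y → Δ (F y) y)) (sym (ℕₚ.+-suc a b))
      (Degree≤-diagonal (suc a) b {λ u → Δ (F u)} (Degree≤-Δ-other (suc a) {F} pu) pv)

Degree≤-* : ∀ a b {f g} → Degree≤ a f → Degree≤ b g → Degree≤ (a ℕ.+ b) (λ x → f x * g x)
Degree≤-* a b {f} {g} p q = Degree≤-diagonal a b
  (λ v → Degree≤-cong a (λ u → ℚₚ.*-comm (g v) (f u)) (Degree≤-scale a (g v) p))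
  (λ u → Degree≤-scale b (f u) q)

sumUpTo : (ℕ → ℚ) → ℕ → ℚ
sumUpTo f zero    = 0ℚ
sumUpTo f (suc n) = sumUpTo f n + f n

antidiff : (ℤ → ℚ) → ℤ → ℚ
antidiff g (+ n)    = sumUpTo (g ∘ +_) n
antidiff g -[1+ n ] = - sumUpTo (g ∘ -[1+_]) (suc n)

antidiff-suc : ∀ g x → antidiff g (ℤ.suc x) ≡ antidiff g x + g x
antidiff-suc g (+ n)         = refl
antidiff-suc g -[1+ zero ]   = solve 1 (λ a → con 0ℚ := :- (con 0ℚ :+ a) :+ a) refl (g -[1+ 0 ])
antidiff-suc g -[1+ suc n ] = solve 2 (λ s a → :- s := :- (s :+ a) :+ a) refl
  (sumUpTo (g ∘ -[1+_]) (suc n)) (g -[1+ suc n ])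

Δ-antidiff : ∀ g → Δ (antidiff g) ≗ g
Δ-antidiff g x = trans (cong (_- antidiff g x) (antidiff-suc g x))
  (solve 2 (λ a b → (a :+ b) :- a := b) refl (antidiff g x) (g x))

Degree≤-antidiff : ∀ d {g} → Degree≤ d g → Degree≤ (suc d) (antidiff g)
Degree≤-antidiff d {g} p = Degree≤-cong d (sym ∘ Δ-antidiff g) p

record IsAdditiveSubgroup {A : Set} (P : (A → ℚ) → Set) : Set where
  field
    0∈ : P (λ _ → 0ℚ)
    +∈ : ∀ {f g} → P f → P g → P (λ a → f a + g a)
    -∈ : ∀ {f} → P f → P (λ a → - f a)

  sumUpTo∈ : (h : ℕ → A → ℚ) → (∀ i → P (h i)) → ∀ n → P (λ a → sumUpTo (λ i → h i a) n)
  sumUpTo∈ h h∈ zero    = 0∈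
  sumUpTo∈ h h∈ (suc n) = +∈ (sumUpTo∈ h h∈ n) (h∈ n)

  antidiff∈ : (h : ℤ → A → ℚ) → (∀ s → P (h s)) → ∀ u → P (λ a → antidiff (λ s → h s a) u)
  antidiff∈ h h∈ (+ n)    = sumUpTo∈ (λ i → h (+ i)) (λ i → h∈ (+ i)) n
  antidiff∈ h h∈ -[1+ n ] = -∈ (sumUpTo∈ (λ i → h -[1+ i ]) (λ i → h∈ -[1+ i ]) (suc n))

Degree≤-isAdditiveSubgroup : ∀ d → IsAdditiveSubgroup (Degree≤ d)
Degree≤-isAdditiveSubgroup d = record
  { 0∈ = Degree≤-const d 0ℚ
  ; +∈ = Degree≤-+ d
  ; -∈ = Degree≤-neg d
  }

Degree≤-0-constant : ∀ {g} → Degree≤ 0 g → ∀ x → g x ≡ g (+ 0)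
Degree≤-0-constant {g} p = go
  where
    step : ∀ x → g (ℤ.suc x) ≡ g x
    step x = x∙y⁻¹≈ε⇒x≈y (g (ℤ.suc x)) (g x) (p x)
    go : ∀ x → g x ≡ g (+ 0)
    go (+ zero)      = refl
    go (+ suc n)     = trans (step (+ n)) (go (+ n))
    go -[1+ zero ]   = sym (step -[1+ 0 ])
    go -[1+ suc n ] = trans (sym (step -[1+ suc n ])) (go -[1+ n ])

Degree≤-vanishing : ∀ d {g} N → Degree≤ d g → (∀ x → x ℤ.≤ N → g x ≡ 0ℚ) → g ≗ (λ _ → 0ℚ)
Degree≤-vanishing d {g} N p g≡0 x = begin
  g x     ≡⟨ Degree≤-0-constant {g} (constant d p) x ⟩
  g (+ 0) ≡⟨ Degree≤-0-constant {g} (constant d p) N ⟨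
  g N     ≡⟨ g≡0 N ℤₚ.≤-refl ⟩
  0ℚ      ∎
  where
    constant : ∀ d → Degree≤ d g → Degree≤ 0 g
    constant zero    p = p
    constant (suc d) p = Degree≤-vanishing d {Δ g} (ℤ.pred N) p Δg≡0
      where
        Δg≡0 : ∀ x → x ℤ.≤ ℤ.pred N → Δ g x ≡ 0ℚ
        Δg≡0 x x≤N-1 = cong₂ _-_ (g≡0 (ℤ.suc x) (ℤₚ.i<j⇒suc[i]≤j x<N)) (g≡0 x (ℤₚ.<⇒≤ x<N))
          where x<N = ℤₚ.i≤pred[j]⇒i<j x≤N-1

Degree≤ᵛ : (n d : ℕ) → (Vec ℤ n → ℚ) → Set
Degree≤ᵛ zero    d f = ⊤
Degree≤ᵛ (suc n) d f = (∀ r → Degree≤ d (λ s → f (s ∷ r))) × (∀ s → Degree≤ᵛ n d (λ r → f (s ∷ r)))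

Degree≤ᵛ-cong : ∀ n d {f g} → f ≗ g → Degree≤ᵛ n d f → Degree≤ᵛ n d g
Degree≤ᵛ-cong zero    d f≗g p         = tt
Degree≤ᵛ-cong (suc n) d f≗g (p₁ , p′) =
  (λ r → Degree≤-cong d (λ s → f≗g (s ∷ r)) (p₁ r)) , (λ s → Degree≤ᵛ-cong n d (λ r → f≗g (s ∷ r)) (p′ s))

Degree≤ᵛ-const : ∀ n d c → Degree≤ᵛ n d (λ _ → c)
Degree≤ᵛ-const zero    d c = tt
Degree≤ᵛ-const (suc n) d c = (λ r → Degree≤-const d c) , (λ s → Degree≤ᵛ-const n d c)

Degree≤ᵛ-map : ∀ {a b} (φ : ℚ → ℚ) → (∀ {g} → Degree≤ a g → Degree≤ b (φ ∘ g)) →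
               ∀ n {f} → Degree≤ᵛ n a f → Degree≤ᵛ n b (φ ∘ f)
Degree≤ᵛ-map φ hom zero    p         = tt
Degree≤ᵛ-map φ hom (suc n) (p₁ , p′) = (λ r → hom (p₁ r)) , (λ s → Degree≤ᵛ-map φ hom n (p′ s))

Degree≤ᵛ-zipWith : ∀ {a b c} (_∙_ : ℚ → ℚ → ℚ) →
                   (∀ {g h} → Degree≤ a g → Degree≤ b h → Degree≤ c (λ x → g x ∙ h x)) →
                   ∀ n {f g} → Degree≤ᵛ n a f → Degree≤ᵛ n b g → Degree≤ᵛ n c (λ k → f k ∙ g k)
Degree≤ᵛ-zipWith _∙_ hom zero    p         q         = tt
Degree≤ᵛ-zipWith _∙_ hom (suc n) (p₁ , p′) (q₁ , q′) =
  (λ r → hom (p₁ r) (q₁ r)) , (λ s → Degree≤ᵛ-zipWith _∙_ hom n (p′ s) (q′ s))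

Degree≤ᵛ-mono : ∀ n {d e f} → d ℕ.≤ e → Degree≤ᵛ n d f → Degree≤ᵛ n e f
Degree≤ᵛ-mono n d≤e = Degree≤ᵛ-map (λ q → q) (Degree≤-mono d≤e) n

Degree≤ᵛ-neg : ∀ n d {f} → Degree≤ᵛ n d f → Degree≤ᵛ n d (λ k → - f k)
Degree≤ᵛ-neg n d = Degree≤ᵛ-map -_ (Degree≤-neg d) n

Degree≤ᵛ-+ : ∀ n d {f g} → Degree≤ᵛ n d f → Degree≤ᵛ n d g → Degree≤ᵛ n d (λ k → f k + g k)
Degree≤ᵛ-+ n d = Degree≤ᵛ-zipWith _+_ (Degree≤-+ d) n

Degree≤ᵛ-- : ∀ n d {f g} → Degree≤ᵛ n d f → Degree≤ᵛ n d g → Degree≤ᵛ n d (λ k → f k - g k)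
Degree≤ᵛ-- n d = Degree≤ᵛ-zipWith _-_ (Degree≤-- d) n

Degree≤ᵛ-* : ∀ n a b {f g} → Degree≤ᵛ n a f → Degree≤ᵛ n b g → Degree≤ᵛ n (a ℕ.+ b) (λ k → f k * g k)
Degree≤ᵛ-* n a b = Degree≤ᵛ-zipWith _*_ (Degree≤-* a b) n

/1-+ : ∀ i j → (i ℤ.+ j) / 1 ≡ i / 1 + j / 1
/1-+ i j = begin
  fromℚᵘ (mkℚᵘ (i ℤ.+ j) 0)
    ≡⟨ ℚₚ.fromℚᵘ-cong {mkℚᵘ (i ℤ.+ j) 0} {mkℚᵘ i 0 ℚᵘ.+ mkℚᵘ j 0}
         (*≡* (ℤ-solve 2 (λ i j → (i ℤ:+ j) ℤ:* ℤcon (+ 1)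
                                    ℤ:= (i ℤ:* ℤcon (+ 1) ℤ:+ j ℤ:* ℤcon (+ 1)) ℤ:* ℤcon (+ 1)) refl i j)) ⟩
  fromℚᵘ (mkℚᵘ i 0 ℚᵘ.+ mkℚᵘ j 0)
    ≡⟨ ℚₚ.fromℚᵘ-cong (ℚᵘₚ.+-cong (ℚₚ.toℚᵘ-fromℚᵘ (mkℚᵘ i 0)) (ℚₚ.toℚᵘ-fromℚᵘ (mkℚᵘ j 0))) ⟨
  fromℚᵘ (toℚᵘ (i / 1) ℚᵘ.+ toℚᵘ (j / 1))
    ≡⟨ ℚₚ.fromℚᵘ-cong (ℚₚ.toℚᵘ-homo-+ (i / 1) (j / 1)) ⟨
  fromℚᵘ (toℚᵘ (i / 1 + j / 1))
    ≡⟨ ℚₚ.fromℚᵘ-toℚᵘ (i / 1 + j / 1) ⟩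
  i / 1 + j / 1 ∎

Degree≤-/1 : Degree≤ 1 (λ s → s / 1)
Degree≤-/1 = Degree≤-cong 0 (λ x → sym (Δ-/1 x)) (Degree≤-const 0 (+ 1 / 1))
  where
    Δ-/1 : ∀ x → Δ (λ s → s / 1) x ≡ + 1 / 1
    Δ-/1 x = trans (cong (_- x / 1) (/1-+ (+ 1) x))
      (solve 2 (λ a b → (a :+ b) :- b := a) refl (+ 1 / 1) (x / 1))

Degree≤ᵛ-lookup : ∀ n (i : Fin n) → Degree≤ᵛ n 1 (λ k → lookup k i / 1)
Degree≤ᵛ-lookup (suc n) Fin.zero    = (λ r → Degree≤-/1) , (λ s → Degree≤ᵛ-const n 1 (s / 1))
Degree≤ᵛ-lookup (suc n) (Fin.suc i) = (λ r → Degree≤-const 1 (lookup r i / 1)) , (λ s → Degree≤ᵛ-lookup n i)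

Degree≤ᵛ-isAdditiveSubgroup : ∀ n d → IsAdditiveSubgroup (Degree≤ᵛ n d)
Degree≤ᵛ-isAdditiveSubgroup n d = record
  { 0∈ = Degree≤ᵛ-const n d 0ℚ
  ; +∈ = Degree≤ᵛ-+ n d
  ; -∈ = Degree≤ᵛ-neg n d
  }

Degree≤ᵛ-tail : ∀ n d {f} → Degree≤ᵛ n d f → Degree≤ᵛ (suc n) d (f ∘ tail)
Degree≤ᵛ-tail n d {f} p = (λ r → Degree≤-const d (f r)) , (λ _ → p)

duplicateHead : ∀ {n} → (Vec ℤ (suc (suc n)) → ℚ) → Vec ℤ (suc n) → ℚ
duplicateHead f k = f (head k ∷ k)

Degree≤ᵛ-duplicateHead : ∀ n d {f} → Degree≤ᵛ (suc (suc n)) d f → Degree≤ᵛ (suc n) (d ℕ.+ d) (duplicateHead f)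
Degree≤ᵛ-duplicateHead n d {f} (p₁ , p′) =
  (λ r → Degree≤-diagonal d d {λ u v → f (u ∷ v ∷ r)} (λ v → p₁ (v ∷ r)) (λ u → proj₁ (p′ u) r))
  , (λ y → Degree≤ᵛ-mono n (ℕₚ.m≤m+n d d) (proj₂ (p′ y) y))

Degree≤ᵛ-vanishing : ∀ n d {f} → Degree≤ᵛ n d f → (∀ k → Linked ℤ._<_ k → f k ≡ 0ℚ) → f ≗ (λ _ → 0ℚ)
Degree≤ᵛ-vanishing zero    d         p         f≡0 []       = f≡0 [] []
Degree≤ᵛ-vanishing (suc n) d {f} (p₁ , p′) f≡0 (x ∷ xs) =
  Degree≤ᵛ-vanishing n d (p′ x) (λ ys ys↑ → vanishing-in-head ys ys↑ x) xs
  where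
    vanishing-in-head : ∀ ys → Linked ℤ._<_ ys → ∀ x → f (x ∷ ys) ≡ 0ℚ
    vanishing-in-head []      _   x = f≡0 (x ∷ []) [-]
    vanishing-in-head (y ∷ r) ys↑ = Degree≤-vanishing d (ℤ.pred y) (p₁ (y ∷ r))
      (λ z z≤y-1 → f≡0 (z ∷ y ∷ r) (ℤₚ.i≤pred[j]⇒i<j z≤y-1 ∷ ys↑))

-- Bounded degree in each variable separately; on ℤⁿ this is equivalent to being a polynomial.
IsPolynomial : ∀ n → (Vec ℤ n → ℚ) → Set
IsPolynomial n f = ∃[ d ] Degree≤ᵛ n d f

isPolynomial-+ : ∀ n {f g} → IsPolynomial n f → IsPolynomial n g → IsPolynomial n (λ k → f k + g k)
isPolynomial-+ n (a , fa) (b , gb) =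
  a ⊔ b , Degree≤ᵛ-+ n (a ⊔ b) (Degree≤ᵛ-mono n (ℕₚ.m≤m⊔n a b) fa) (Degree≤ᵛ-mono n (ℕₚ.m≤n⊔m a b) gb)

isPolynomial-- : ∀ n {f g} → IsPolynomial n f → IsPolynomial n g → IsPolynomial n (λ k → f k - g k)
isPolynomial-- n (a , fa) (b , gb) =
  a ⊔ b , Degree≤ᵛ-- n (a ⊔ b) (Degree≤ᵛ-mono n (ℕₚ.m≤m⊔n a b) fa) (Degree≤ᵛ-mono n (ℕₚ.m≤n⊔m a b) gb)

eval-isPolynomial : ∀ {n} (p : Poly n) → IsPolynomial n (eval p)
eval-isPolynomial {n} (const q) = 0 , Degree≤ᵛ-const n 0 q
eval-isPolynomial {n} (var i)   = 1 , Degree≤ᵛ-lookup n i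
eval-isPolynomial {n} (p ⊕ q)   = isPolynomial-+ n (eval-isPolynomial p) (eval-isPolynomial q)
eval-isPolynomial {n} (p ⊗ q) with eval-isPolynomial p | eval-isPolynomial q
... | a , pa | b , qb = a ℕ.+ b , Degree≤ᵛ-* n a b pa qb

isPolynomial-≗-on-increasing⇒≗ : ∀ n {f g} → IsPolynomial n f → IsPolynomial n g →
                                 (∀ k → Linked ℤ._<_ k → f k ≡ g k) → f ≗ g
isPolynomial-≗-on-increasing⇒≗ n {f} {g} pf pg f≡g k =
  x∙y⁻¹≈ε⇒x≈y (f k) (g k) (Degree≤ᵛ-vanishing n _ (proj₂ (isPolynomial-- n pf pg)) f-g≡0 k)
  where
    f-g≡0 : ∀ k → Linked ℤ._<_ k → f k - g k ≡ 0ℚ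
    f-g≡0 k k↑ = trans (cong (_- g k) (f≡g k k↑)) (ℚₚ.+-inverseʳ (g k))

sumℚ : List ℚ → ℚ
sumℚ []       = 0ℚ
sumℚ (q ∷ qs) = q + sumℚ qs

sumℚ-++ : ∀ ps qs → sumℚ (ps ++ qs) ≡ sumℚ ps + sumℚ qs
sumℚ-++ []       qs = sym (ℚₚ.+-identityˡ (sumℚ qs))
sumℚ-++ (p ∷ ps) qs = trans (cong (_+_ p) (sumℚ-++ ps qs)) (sym (ℚₚ.+-assoc p (sumℚ ps) (sumℚ qs)))

+-suc : ∀ x n → x ℤ.+ + suc n ≡ ℤ.suc (x ℤ.+ + n)
+-suc x n = ℤ-solve 2 (λ x n → x ℤ:+ (ℤcon (+ 1) ℤ:+ n) ℤ:= ℤcon (+ 1) ℤ:+ (x ℤ:+ n)) refl x (+ n)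

+∣-∣-cancel : ∀ {x y} → x ℤ.≤ y → x ℤ.+ + ℤ.∣ y ℤ.- x ∣ ≡ y
+∣-∣-cancel {x} {y} x≤y = trans (cong (ℤ._+_ x) (ℤₚ.0≤i⇒+∣i∣≡i (ℤₚ.i≤j⇒0≤j-i x≤y)))
  (ℤ-solve 2 (λ x y → x ℤ:+ (y ℤ:- x) ℤ:= y) refl x y)

sumℚ-applyUpTo-antidiff : ∀ g x n → sumℚ (applyUpTo (λ i → g (x ℤ.+ + i)) n) ≡ antidiff g (x ℤ.+ + n) - antidiff g x
sumℚ-applyUpTo-antidiff g x zero    = sym (trans (cong (λ z → antidiff g z - antidiff g x) (ℤₚ.+-identityʳ x))
                                            (ℚₚ.+-inverseʳ (antidiff g x)))
sumℚ-applyUpTo-antidiff g x (suc n) = begin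
  sumℚ (applyUpTo h (suc n))
    ≡⟨ cong sumℚ (Listₚ.applyUpTo-∷ʳ h n) ⟨
  sumℚ (applyUpTo h n ∷ʳ h n)
    ≡⟨ sumℚ-++ (applyUpTo h n) (h n ∷ []) ⟩
  sumℚ (applyUpTo h n) + (h n + 0ℚ)
    ≡⟨ cong₂ _+_ (sumℚ-applyUpTo-antidiff g x n) (ℚₚ.+-identityʳ (h n)) ⟩
  (antidiff g (x ℤ.+ + n) - antidiff g x) + h n
    ≡⟨ solve 3 (λ a b c → (a :- b) :+ c := (a :+ c) :- b) refl (antidiff g (x ℤ.+ + n)) (antidiff g x) (h n) ⟩
  (antidiff g (x ℤ.+ + n) + h n) - antidiff g x
    ≡⟨ cong (_- antidiff g x) (antidiff-suc g (x ℤ.+ + n)) ⟨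
  antidiff g (ℤ.suc (x ℤ.+ + n)) - antidiff g x
    ≡⟨ cong (λ z → antidiff g z - antidiff g x) (+-suc x n) ⟨
  antidiff g (x ℤ.+ + suc n) - antidiff g x ∎
  where
    h : ℕ → ℚ
    h i = g (x ℤ.+ + i)

range≡applyUpTo : ∀ {x y} → x ℤ.≤ y → range x y ≡ applyUpTo (λ i → x ℤ.+ + i) (suc ℤ.∣ y ℤ.- x ∣)
range≡applyUpTo {x} {y} x≤y with x ℤ.≤? y
... | yes _   = Listₚ.map-upTo (λ i → x ℤ.+ + i) _
... | no x≰y = contradiction x≤y x≰y

range-empty : ∀ {x y} → y ℤ.< x → range x y ≡ []
range-empty {x} {y} y<x with x ℤ.≤? y
... | yes x≤y = contradiction x≤y (ℤₚ.<⇒≱ y<x)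
... | no _    = refl

range-bounded : ∀ x y → All (λ s → x ℤ.≤ s × s ℤ.≤ y) (range x y)
range-bounded x y with x ℤ.≤? y
... | no _    = []
... | yes x≤y = subst (All _) (sym (Listₚ.map-upTo _ _)) (Allₚ.applyUpTo⁺₁ _ _ bounds)
  where
    bounds : ∀ {i} → i ℕ.< suc ℤ.∣ y ℤ.- x ∣ → x ℤ.≤ x ℤ.+ + i × x ℤ.+ + i ℤ.≤ y
    bounds i<n = ℤₚ.i≤i+j x (+ _)
               , subst (_ ℤ.≤_) (+∣-∣-cancel x≤y) (ℤₚ.+-monoʳ-≤ x (ℤ.+≤+ (ℕₚ.≤-pred i<n)))

sumRange : ℤ → ℤ → (ℤ → ℚ) → ℚ
sumRange x y g = sumℚ (List.map g (range x y))

sumRange-antidiff : ∀ g {x y} → x ℤ.≤ ℤ.suc y → sumRange x y g ≡ antidiff g (ℤ.suc y) - antidiff g x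
sumRange-antidiff g {x} {y} x≤y+1 = by-cases (x ℤ.≤? y)
  where
    by-cases : Dec (x ℤ.≤ y) → sumRange x y g ≡ antidiff g (ℤ.suc y) - antidiff g x
    by-cases (yes x≤y) = begin
      sumℚ (List.map g (range x y))
        ≡⟨ cong (sumℚ ∘ List.map g) (range≡applyUpTo x≤y) ⟩
      sumℚ (List.map g (applyUpTo (λ i → x ℤ.+ + i) (suc n)))
        ≡⟨ cong sumℚ (Listₚ.map-applyUpTo (λ i → x ℤ.+ + i) g (suc n)) ⟩
      sumℚ (applyUpTo (λ i → g (x ℤ.+ + i)) (suc n))
        ≡⟨ sumℚ-applyUpTo-antidiff g x (suc n) ⟩
      antidiff g (x ℤ.+ + suc n) - antidiff g x
        ≡⟨ cong (λ z → antidiff g z - antidiff g x) (trans (+-suc x n) (cong ℤ.suc (+∣-∣-cancel x≤y))) ⟩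
      antidiff g (ℤ.suc y) - antidiff g x ∎
      where n = ℤ.∣ y ℤ.- x ∣
    by-cases (no x≰y) = begin
      sumℚ (List.map g (range x y))         ≡⟨ cong (sumℚ ∘ List.map g) (range-empty y<x) ⟩
      0ℚ                                    ≡⟨ ℚₚ.+-inverseʳ (antidiff g x) ⟨
      antidiff g x - antidiff g x           ≡⟨ cong (λ z → antidiff g z - antidiff g x) x≡y+1 ⟩
      antidiff g (ℤ.suc y) - antidiff g x   ∎
      where
        y<x = ℤₚ.≰⇒> x≰y
        x≡y+1 = ℤₚ.≤-antisym x≤y+1 (ℤₚ.i<j⇒suc[i]≤j y<x)

sumRange-cong : ∀ x y {g h} → (∀ s → x ℤ.≤ s → s ℤ.≤ y → g s ≡ h s) → sumRange x y g ≡ sumRange x y h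
sumRange-cong x y g≡h =
  cong sumℚ (Listₚ.map-cong-local (All.map (λ (x≤s , s≤y) → g≡h _ x≤s s≤y) (range-bounded x y)))

sumRange-head : ∀ g {x y} → x ℤ.≤ y → sumRange x y g ≡ g x + sumRange (ℤ.suc x) y g
sumRange-head g {x} {y} x≤y = begin
  sumRange x y g
    ≡⟨ sumRange-antidiff g (ℤₚ.≤-trans x≤y (ℤₚ.i≤suc[i] y)) ⟩
  antidiff g (ℤ.suc y) - antidiff g x
    ≡⟨ solve 3 (λ a b c → a :- b := c :+ (a :- (b :+ c))) refl (antidiff g (ℤ.suc y)) (antidiff g x) (g x) ⟩
  g x + (antidiff g (ℤ.suc y) - (antidiff g x + g x))
    ≡⟨ cong (λ z → g x + (antidiff g (ℤ.suc y) - z)) (antidiff-suc g x) ⟨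
  g x + (antidiff g (ℤ.suc y) - antidiff g (ℤ.suc x))
    ≡⟨ cong (_+_ (g x)) (sumRange-antidiff g (ℤₚ.+-monoʳ-≤ (+ 1) x≤y)) ⟨
  g x + sumRange (ℤ.suc x) y g ∎

antidiff-sub-cong : ∀ {x y} g h → x ℤ.≤ y → (∀ s → x ℤ.≤ s → s ℤ.< y → g s ≡ h s) →
                    antidiff g y - antidiff g x ≡ antidiff h y - antidiff h x
antidiff-sub-cong {x} {y} g h x≤y g≡h = begin
  antidiff g y - antidiff g x  ≡⟨ as-sumRange g ⟩
  sumRange x (ℤ.pred y) g      ≡⟨ sumRange-cong x (ℤ.pred y) (λ s x≤s s≤y-1 → g≡h s x≤s (ℤₚ.i≤pred[j]⇒i<j s≤y-1)) ⟩
  sumRange x (ℤ.pred y) h      ≡⟨ as-sumRange h ⟨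
  antidiff h y - antidiff h x  ∎
  where
    as-sumRange : ∀ f → antidiff f y - antidiff f x ≡ sumRange x (ℤ.pred y) f
    as-sumRange f = trans (cong (λ z → antidiff f z - antidiff f x) (sym (ℤₚ.suc-pred y)))
                          (sym (sumRange-antidiff f (subst (x ℤ.≤_) (sym (ℤₚ.suc-pred y)) x≤y)))

sumℚ-map-concatMap : ∀ {A B : Set} (w : B → ℚ) (f : A → List B) xs →
                     sumℚ (List.map w (List.concatMap f xs)) ≡ sumℚ (List.map (λ a → sumℚ (List.map w (f a))) xs)
sumℚ-map-concatMap w f []       = refl
sumℚ-map-concatMap w f (a ∷ xs) = begin
  sumℚ (List.map w (f a ++ List.concatMap f xs))
    ≡⟨ cong sumℚ (Listₚ.map-++ w (f a) (List.concatMap f xs)) ⟩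
  sumℚ (List.map w (f a) ++ List.map w (List.concatMap f xs))
    ≡⟨ sumℚ-++ (List.map w (f a)) _ ⟩
  sumℚ (List.map w (f a)) + sumℚ (List.map w (List.concatMap f xs))
    ≡⟨ cong (_+_ (sumℚ (List.map w (f a)))) (sumℚ-map-concatMap w f xs) ⟩
  sumℚ (List.map w (f a)) + sumℚ (List.map (λ a → sumℚ (List.map w (f a))) xs) ∎

sumℚ-map-0 : ∀ {A : Set} (xs : List A) → sumℚ (List.map (λ _ → 0ℚ) xs) ≡ 0ℚ
sumℚ-map-0 []       = refl
sumℚ-map-0 (x ∷ xs) = cong (_+_ 0ℚ) (sumℚ-map-0 xs)

Interlaces : ∀ {m} → Vec ℤ (suc m) → Vec ℤ m → Set
Interlaces (x ∷ [])    []      = ⊤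
Interlaces (x ∷ y ∷ r) (s ∷ l) = (x ℤ.≤ s × s ℤ.≤ y) × Interlaces (y ∷ r) l

sumInterlacing : ∀ {m} → Vec ℤ (suc m) → (Vec ℤ m → ℚ) → ℚ
sumInterlacing (x ∷ [])    w = w []
sumInterlacing (x ∷ y ∷ r) w = sumRange x y (λ s → sumInterlacing (y ∷ r) (w ∘ (s ∷_)))

sumInterlacing-cong : ∀ {m} (k : Vec ℤ (suc m)) {w w′} → (∀ l → Interlaces k l → w l ≡ w′ l) →
                      sumInterlacing k w ≡ sumInterlacing k w′
sumInterlacing-cong (x ∷ [])    w≡w′ = w≡w′ [] tt
sumInterlacing-cong (x ∷ y ∷ r) w≡w′ = sumRange-cong x y λ s x≤s s≤y →
  sumInterlacing-cong (y ∷ r) (λ l l↑ → w≡w′ (s ∷ l) ((x≤s , s≤y) , l↑))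

sumInterlacing-0 : ∀ {m} (k : Vec ℤ (suc m)) {w} → (∀ l → Interlaces k l → w l ≡ 0ℚ) → sumInterlacing k w ≡ 0ℚ
sumInterlacing-0 k w≡0 = trans (sumInterlacing-cong k w≡0) (zero-sum k)
  where
    zero-sum : ∀ {m} (k : Vec ℤ (suc m)) → sumInterlacing k (λ _ → 0ℚ) ≡ 0ℚ
    zero-sum (x ∷ [])    = refl
    zero-sum (x ∷ y ∷ r) = trans (sumRange-cong x y (λ s _ _ → zero-sum (y ∷ r))) (sumℚ-map-0 (range x y))

sumℚ-interlacing : ∀ {m} (k : Vec ℤ (suc m)) w → sumℚ (List.map w (interlacing k)) ≡ sumInterlacing k w
sumℚ-interlacing (x ∷ [])    w = ℚₚ.+-identityʳ (w [])
sumℚ-interlacing (x ∷ y ∷ r) w =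
  trans (sumℚ-map-concatMap w (λ s → List.map (s ∷_) (interlacing (y ∷ r))) (range x y))
        (cong sumℚ (Listₚ.map-cong inner (range x y)))
  where
    inner : ∀ s → sumℚ (List.map w (List.map (s ∷_) (interlacing (y ∷ r)))) ≡ sumInterlacing (y ∷ r) (w ∘ (s ∷_))
    inner s = trans (cong sumℚ (sym (Listₚ.map-∘ (interlacing (y ∷ r))))) (sumℚ-interlacing (y ∷ r) (w ∘ (s ∷_)))

sum-filter-strictRow : ∀ {m} (c : Vec ℤ m → ℕ) ls →
  + sum (List.map c (List.filter (λ s → strictRow s Bool.≟ true) ls)) / 1
    ≡ sumℚ (List.map (λ l → if strictRow l then + c l / 1 else 0ℚ) ls)
sum-filter-strictRow c []       = refl
sum-filter-strictRow c (l ∷ ls) with strictRow l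
... | true  = trans (/1-+ (+ c l) (+ sum (List.map c (List.filter (λ s → strictRow s Bool.≟ true) ls))))
                    (cong (_+_ (+ c l / 1)) (sum-filter-strictRow c ls))
... | false = trans (sum-filter-strictRow c ls) (sym (ℚₚ.+-identityˡ _))

countℚ : ∀ {m} → Vec ℤ (suc m) → ℚ
countℚ k = + countGTStrictAbove k / 1

countℚ-recursion : ∀ {m} (k : Vec ℤ (suc (suc m))) →
                   countℚ k ≡ sumInterlacing k (λ l → if strictRow l then countℚ l else 0ℚ)
countℚ-recursion k = trans (sum-filter-strictRow countGTStrictAbove (interlacing k)) (sumℚ-interlacing k _)

data Left : Set where
  weak strict : Left

-- For weakly increasing k, rowSum b φ k is the sum of φ over the strictly increasing rows l
-- interlacing k (with k₁ < l₁ when b = strict). Splitting on the first entry s of l, the terms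
-- with s < k₂ are summed by an antidifference, which makes the result a polynomial in k.
mutual
  rowSum : ∀ {m} → Left → (Vec ℤ m → ℚ) → Vec ℤ (suc m) → ℚ
  rowSum b      φ (x ∷ [])    = φ []
  rowSum weak   φ (x ∷ y ∷ r) = rowSumStep φ x (y ∷ r)
  rowSum strict φ (x ∷ y ∷ r) = rowSumStep φ x (y ∷ r) - rowSum weak (φ ∘ (x ∷_)) (y ∷ r)

  rowSumStep : ∀ {m} → (Vec ℤ (suc m) → ℚ) → ℤ → Vec ℤ (suc m) → ℚ
  rowSumStep φ x (y ∷ r) = (antidiff g y - antidiff g x) + rowSum strict (φ ∘ (y ∷_)) (y ∷ r)
    where
      g : ℤ → ℚ
      g s = rowSum weak (φ ∘ (s ∷_)) (y ∷ r)

module _ {A : Set} {P : (A → ℚ) → Set} (P-subgroup : IsAdditiveSubgroup P) where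
  open IsAdditiveSubgroup P-subgroup

  mutual
    rowSum∈ : ∀ b {m} (ψ : A → Vec ℤ m → ℚ) → (∀ l → P (λ a → ψ a l)) → ∀ k → P (λ a → rowSum b (ψ a) k)
    rowSum∈ b      ψ ψ∈ (x ∷ [])    = ψ∈ []
    rowSum∈ weak   ψ ψ∈ (x ∷ y ∷ r) = rowSumStep∈ ψ ψ∈ x (y ∷ r)
    rowSum∈ strict ψ ψ∈ (x ∷ y ∷ r) =
      +∈ (rowSumStep∈ ψ ψ∈ x (y ∷ r)) (-∈ (rowSum∈ weak (λ a → ψ a ∘ (x ∷_)) (ψ∈ ∘ (x ∷_)) (y ∷ r)))

    rowSumStep∈ : ∀ {m} (ψ : A → Vec ℤ (suc m) → ℚ) → (∀ l → P (λ a → ψ a l)) →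
                  ∀ x k → P (λ a → rowSumStep (ψ a) x k)
    rowSumStep∈ ψ ψ∈ x (y ∷ r) =
      +∈ (+∈ (antidiff-g∈ y) (-∈ (antidiff-g∈ x))) (rowSum∈ strict (λ a → ψ a ∘ (y ∷_)) (ψ∈ ∘ (y ∷_)) (y ∷ r))
      where
        antidiff-g∈ : ∀ u → P (λ a → antidiff (λ s → rowSum weak (ψ a ∘ (s ∷_)) (y ∷ r)) u)
        antidiff-g∈ = antidiff∈ (λ s a → rowSum weak (ψ a ∘ (s ∷_)) (y ∷ r))
                        (λ s → rowSum∈ weak (λ a → ψ a ∘ (s ∷_)) (ψ∈ ∘ (s ∷_)) (y ∷ r))

rowSumDegree : ℕ → ℕ → ℕ
rowSumDegree zero    d = d
rowSumDegree (suc m) d = suc (rowSumDegree m d) ℕ.+ suc (rowSumDegree m d)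

d≤rowSumDegree : ∀ m d → d ℕ.≤ rowSumDegree m d
d≤rowSumDegree zero    d = ℕₚ.≤-refl
d≤rowSumDegree (suc m) d = ℕₚ.≤-trans (ℕₚ.m≤n⇒m≤1+n (d≤rowSumDegree m d)) (ℕₚ.m≤m+n _ _)

rowSum-Degree≤ᵛ : ∀ b m d {φ} → Degree≤ᵛ m d φ → Degree≤ᵛ (suc m) (rowSumDegree m d) (rowSum b φ)
rowSum-Degree≤ᵛ b zero    d {φ} _          = (λ { [] → Degree≤-const d (φ []) }) , (λ _ → tt)
rowSum-Degree≤ᵛ b (suc m) d {φ} (p₁ , p′) = by-left b
  where
    e = rowSumDegree m d
    n = suc (suc m)

    Ψ : Left → Vec ℤ n → ℚ
    Ψ b (s ∷ k) = rowSum b (φ ∘ (s ∷_)) k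

    Ψ-Degree≤ᵛ : ∀ b → Degree≤ᵛ n e (Ψ b)
    Ψ-Degree≤ᵛ b =
        (λ k → Degree≤-mono (d≤rowSumDegree m d) (rowSum∈ (Degree≤-isAdditiveSubgroup d) b (λ s → φ ∘ (s ∷_)) p₁ k))
      , (λ s → rowSum-Degree≤ᵛ b m d (p′ s))

    A : Vec ℤ n → ℚ
    A (u ∷ k) = antidiff (λ s → Ψ weak (s ∷ k)) u

    A-Degree≤ᵛ : Degree≤ᵛ n (suc e) A
    A-Degree≤ᵛ =
        (λ k → Degree≤-antidiff e (proj₁ (Ψ-Degree≤ᵛ weak) k))
      , IsAdditiveSubgroup.antidiff∈ (Degree≤ᵛ-isAdditiveSubgroup (suc m) (suc e)) (λ s k → Ψ weak (s ∷ k))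
          (λ s → Degree≤ᵛ-mono (suc m) {f = Ψ weak ∘ (s ∷_)} (ℕₚ.n≤1+n e) (proj₂ (Ψ-Degree≤ᵛ weak) s))

    -- rowSum weak φ (x ∷ y ∷ r) = A (y ∷ y ∷ r) - A (x ∷ y ∷ r) + Ψ strict (y ∷ y ∷ r)
    step : Vec ℤ n → ℚ
    step k = (duplicateHead A (tail k) - A k) + duplicateHead (Ψ strict) (tail k)

    step-Degree≤ᵛ : Degree≤ᵛ n (suc e ℕ.+ suc e) step
    step-Degree≤ᵛ = Degree≤ᵛ-+ n _ {λ k → duplicateHead A (tail k) - A k} {duplicateHead (Ψ strict) ∘ tail}
      (Degree≤ᵛ-- n _ {duplicateHead A ∘ tail} {A}
        (Degree≤ᵛ-tail (suc m) _ {duplicateHead A} (Degree≤ᵛ-duplicateHead m (suc e) {A} A-Degree≤ᵛ))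
        (Degree≤ᵛ-mono n {f = A} (ℕₚ.m≤m+n _ _) A-Degree≤ᵛ))
      (Degree≤ᵛ-mono n {f = duplicateHead (Ψ strict) ∘ tail} (ℕₚ.+-mono-≤ (ℕₚ.n≤1+n e) (ℕₚ.n≤1+n e))
        (Degree≤ᵛ-tail (suc m) _ {duplicateHead (Ψ strict)} (Degree≤ᵛ-duplicateHead m e {Ψ strict} (Ψ-Degree≤ᵛ strict))))

    by-left : ∀ b → Degree≤ᵛ n (suc e ℕ.+ suc e) (rowSum b φ)
    by-left weak   = Degree≤ᵛ-cong n _ {step} {rowSum weak φ} (λ { (x ∷ y ∷ r) → refl }) step-Degree≤ᵛ
    by-left strict = Degree≤ᵛ-cong n _ {λ k → step k - Ψ weak k} {rowSum strict φ} (λ { (x ∷ y ∷ r) → refl })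
      (Degree≤ᵛ-- n _ {step} {Ψ weak} step-Degree≤ᵛ
        (Degree≤ᵛ-mono n {f = Ψ weak} (ℕₚ.≤-trans (ℕₚ.n≤1+n e) (ℕₚ.m≤m+n _ _)) (Ψ-Degree≤ᵛ weak)))

HasTriple : ∀ {m} → Vec ℤ m → Set
HasTriple (a ∷ b ∷ c ∷ t) = (a ≡ b × b ≡ c) ⊎ HasTriple (b ∷ c ∷ t)
HasTriple _               = ⊥

HasDoubleHead : ℤ → ∀ {m} → Vec ℤ m → Set
HasDoubleHead x (a ∷ b ∷ t) = a ≡ x × b ≡ x
HasDoubleHead x _           = ⊥

VanishesOnTriples : ∀ {m} → Vec ℤ (suc m) → (Vec ℤ m → ℚ) → Set
VanishesOnTriples k φ = ∀ l → Interlaces k l → HasTriple l → φ l ≡ 0ℚ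

VanishesOnDoubleHead : ℤ → ∀ {m} → Vec ℤ (suc m) → (Vec ℤ m → ℚ) → Set
VanishesOnDoubleHead x k φ = ∀ l → Interlaces k l → HasDoubleHead x l → φ l ≡ 0ℚ

vanishesOnTriples-∷ : ∀ {m} {x y s} {r : Vec ℤ m} {φ} → VanishesOnTriples (x ∷ y ∷ r) φ →
                      x ℤ.≤ s → s ℤ.≤ y → VanishesOnTriples (y ∷ r) (φ ∘ (s ∷_))
vanishesOnTriples-∷ φ≡0 x≤s s≤y (a ∷ b ∷ c ∷ t) l↑ triple = φ≡0 _ ((x≤s , s≤y) , l↑) (inj₂ triple)

vanishesOnDoubleHead-∷ : ∀ {m} {x y} {r : Vec ℤ m} {φ} → VanishesOnTriples (x ∷ y ∷ r) φ →
                         x ℤ.≤ y → VanishesOnDoubleHead y (y ∷ r) (φ ∘ (y ∷_))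
vanishesOnDoubleHead-∷ φ≡0 x≤y (a ∷ b ∷ t) l↑ (a≡y , b≡y) =
  φ≡0 _ ((x≤y , ℤₚ.≤-refl) , l↑) (inj₁ (sym a≡y , trans a≡y (sym b≡y)))

strictRow-< : ∀ {m} {x y} (l : Vec ℤ m) → x ℤ.< y → strictRow (x ∷ y ∷ l) ≡ strictRow (y ∷ l)
strictRow-< {x = x} {y} l x<y =
  cong (_∧ strictRow (y ∷ l)) (trans (isYes≗does (x ℤ.<? y)) (dec-true (x ℤ.<? y) x<y))

strictRow-≮ : ∀ {m} {x y} (l : Vec ℤ m) → ¬ x ℤ.< y → strictRow (x ∷ y ∷ l) ≡ false
strictRow-≮ {x = x} {y} l x≮y =
  cong (_∧ strictRow (y ∷ l)) (trans (isYes≗does (x ℤ.<? y)) (dec-false (x ℤ.<? y) x≮y))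

interlaces-head : ∀ {m} {y a} {r : Vec ℤ (suc m)} {l} → Interlaces (y ∷ r) (a ∷ l) → y ℤ.≤ a
interlaces-head {r = _ ∷ _} ((y≤a , _) , _) = y≤a

strictRow-interlacing-< : ∀ {m} {s y} {r : Vec ℤ m} l → s ℤ.< y → Interlaces (y ∷ r) l → strictRow (s ∷ l) ≡ strictRow l
strictRow-interlacing-< []      s<y _  = refl
strictRow-interlacing-< (a ∷ l) s<y l↑ = strictRow-< l (ℤₚ.<-≤-trans s<y (interlaces-head l↑))

strictRow-interlacing-triple : ∀ {m} (k : Vec ℤ (suc m)) l → Interlaces k l → HasTriple k → strictRow l ≡ false
strictRow-interlacing-triple (a ∷ b ∷ c ∷ t) (s₁ ∷ s₂ ∷ l) ((a≤s₁ , _) , (_ , s₂≤c) , _) (inj₁ (a≡b , b≡c)) =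
  strictRow-≮ l (λ s₁<s₂ → ℤₚ.<⇒≱ s₁<s₂ (ℤₚ.≤-trans s₂≤c (subst (ℤ._≤ s₁) (trans a≡b b≡c) a≤s₁)))
strictRow-interlacing-triple (a ∷ b ∷ c ∷ t) (s₁ ∷ s₂ ∷ l) (_ , l↑) (inj₂ triple) =
  trans (cong (⌊ s₁ ℤ.<? s₂ ⌋ ∧_) (strictRow-interlacing-triple (b ∷ c ∷ t) (s₂ ∷ l) l↑ triple))
        (Boolₚ.∧-zeroʳ _)

interlaces-weaklyIncreasing : ∀ {m} (k : Vec ℤ (suc m)) l → Linked ℤ._≤_ k → Interlaces k l → Linked ℤ._≤_ l
interlaces-weaklyIncreasing (x ∷ [])        []            _               _ = []
interlaces-weaklyIncreasing (x ∷ y ∷ [])    (s ∷ [])      _               _ = [-]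
interlaces-weaklyIncreasing (x ∷ y ∷ z ∷ r) (s ∷ a ∷ l) (_ ∷ k↑) ((_ , s≤y) , l↑@((y≤a , _) , _)) =
  ℤₚ.≤-trans s≤y y≤a ∷ interlaces-weaklyIncreasing (y ∷ z ∷ r) (a ∷ l) k↑ l↑

if-0 : ∀ b {q} → q ≡ 0ℚ → (if b then q else 0ℚ) ≡ 0ℚ
if-0 true  q≡0 = q≡0
if-0 false _   = refl

-- The two sides differ only when l starts with x, which forces l₁ = x = y.
if-strictRow-∷ : ∀ {m} {x y} {r : Vec ℤ m} {φ} → x ℤ.≤ y → VanishesOnDoubleHead x (x ∷ y ∷ r) φ →
                 ∀ l → Interlaces (y ∷ r) l →
                 (if strictRow (x ∷ l) then φ (x ∷ l) else 0ℚ) ≡ (if strictRow l then φ (x ∷ l) else 0ℚ)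
if-strictRow-∷         x≤y φ≡0 []      _  = refl
if-strictRow-∷ {x = x} x≤y φ≡0 (a ∷ l) l↑ with x ℤ.<? a
... | yes _  = refl
... | no x≮a = sym (if-0 (strictRow (a ∷ l)) (φ≡0 (x ∷ a ∷ l) ((ℤₚ.≤-refl , x≤y) , l↑) (refl , a≡x)))
  where a≡x = ℤₚ.≤-antisym (ℤₚ.≮⇒≥ x≮a) (ℤₚ.≤-trans x≤y (interlaces-head l↑))

mutual
  rowSum-weak≡sumInterlacing : ∀ {m} (k : Vec ℤ (suc m)) φ → Linked ℤ._≤_ k → VanishesOnTriples k φ →
                               rowSum weak φ k ≡ sumInterlacing k (λ l → if strictRow l then φ l else 0ℚ)
  rowSum-weak≡sumInterlacing (x ∷ [])    φ _  _   = refl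
  rowSum-weak≡sumInterlacing (x ∷ y ∷ r) φ k↑ φ≡0 = rowSumStep≡sumInterlacing x y r φ k↑ φ≡0

  rowSumStep≡sumInterlacing : ∀ {m} x y (r : Vec ℤ m) φ →
                              Linked ℤ._≤_ (x ∷ y ∷ r) → VanishesOnTriples (x ∷ y ∷ r) φ →
                              rowSumStep φ x (y ∷ r) ≡ sumInterlacing (x ∷ y ∷ r) (λ l → if strictRow l then φ l else 0ℚ)
  rowSumStep≡sumInterlacing x y r φ (x≤y ∷ yr↑) φ≡0 = begin
    (antidiff h y - antidiff h x) + rowSum strict (φ ∘ (y ∷_)) (y ∷ r)
      ≡⟨ cong₂ _+_ (antidiff-sub-cong h g x≤y h≡g)
                   (rowSum-strict≡sumInterlacing y r (φ ∘ (y ∷_)) yr↑ (vanishesOnTriples-∷ φ≡0 x≤y ℤₚ.≤-refl)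
                                                                   (vanishesOnDoubleHead-∷ φ≡0 x≤y)) ⟩
    (antidiff g y - antidiff g x) + g y
      ≡⟨ solve 3 (λ a b c → (a :- b) :+ c := (a :+ c) :- b) refl (antidiff g y) (antidiff g x) (g y) ⟩
    (antidiff g y + g y) - antidiff g x
      ≡⟨ cong (_- antidiff g x) (antidiff-suc g y) ⟨
    antidiff g (ℤ.suc y) - antidiff g x
      ≡⟨ sumRange-antidiff g (ℤₚ.≤-trans x≤y (ℤₚ.i≤suc[i] y)) ⟨
    sumRange x y g ∎
    where
      h g : ℤ → ℚ
      h s = rowSum weak (φ ∘ (s ∷_)) (y ∷ r)
      g s = sumInterlacing (y ∷ r) (λ l → if strictRow (s ∷ l) then φ (s ∷ l) else 0ℚ)
      h≡g : ∀ s → x ℤ.≤ s → s ℤ.< y → h s ≡ g s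
      h≡g s x≤s s<y =
        trans (rowSum-weak≡sumInterlacing (y ∷ r) (φ ∘ (s ∷_)) yr↑ (vanishesOnTriples-∷ φ≡0 x≤s (ℤₚ.<⇒≤ s<y)))
              (sumInterlacing-cong (y ∷ r) λ l l↑ →
                cong (λ b → if b then φ (s ∷ l) else 0ℚ) (sym (strictRow-interlacing-< l s<y l↑)))

  rowSum-strict≡sumInterlacing : ∀ {m} x (r : Vec ℤ m) φ → Linked ℤ._≤_ (x ∷ r) →
                                 VanishesOnTriples (x ∷ r) φ → VanishesOnDoubleHead x (x ∷ r) φ →
                                 rowSum strict φ (x ∷ r)
                                   ≡ sumInterlacing (x ∷ r) (λ l → if strictRow (x ∷ l) then φ l else 0ℚ)
  rowSum-strict≡sumInterlacing x []      φ _ _ _ = refl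
  rowSum-strict≡sumInterlacing x (y ∷ r) φ k↑@(x≤y ∷ yr↑) φ≡0 φ≡0′ = begin
    rowSumStep φ x (y ∷ r) - rowSum weak (φ ∘ (x ∷_)) (y ∷ r)
      ≡⟨ cong₂ _-_ (rowSumStep≡sumInterlacing x y r φ k↑ φ≡0)
                   (rowSum-weak≡sumInterlacing (y ∷ r) (φ ∘ (x ∷_)) yr↑ (vanishesOnTriples-∷ φ≡0 ℤₚ.≤-refl x≤y)) ⟩
    sumRange x y g - z
      ≡⟨ cong (_- z) (sumRange-head g x≤y) ⟩
    (g x + sumRange (ℤ.suc x) y g) - z
      ≡⟨ cong₂ (λ a b → (a + b) - z) gx≡z (sumRange-cong (ℤ.suc x) y g≡g′) ⟩
    (z + sumRange (ℤ.suc x) y g′) - z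
      ≡⟨ solve 2 (λ z s → (z :+ s) :- z := con 0ℚ :+ s) refl z (sumRange (ℤ.suc x) y g′) ⟩
    0ℚ + sumRange (ℤ.suc x) y g′
      ≡⟨ cong (_+ sumRange (ℤ.suc x) y g′) g′x≡0 ⟨
    g′ x + sumRange (ℤ.suc x) y g′
      ≡⟨ sumRange-head g′ x≤y ⟨
    sumRange x y g′ ∎
    where
      z : ℚ
      z = sumInterlacing (y ∷ r) (λ l → if strictRow l then φ (x ∷ l) else 0ℚ)
      g g′ : ℤ → ℚ
      g  s = sumInterlacing (y ∷ r) (λ l → if strictRow (s ∷ l) then φ (s ∷ l) else 0ℚ)
      g′ s = sumInterlacing (y ∷ r) (λ l → if strictRow (x ∷ s ∷ l) then φ (s ∷ l) else 0ℚ)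
      gx≡z : g x ≡ z
      gx≡z = sumInterlacing-cong (y ∷ r) (if-strictRow-∷ x≤y φ≡0′)
      g≡g′ : ∀ s → ℤ.suc x ℤ.≤ s → s ℤ.≤ y → g s ≡ g′ s
      g≡g′ s x<s _ = sumInterlacing-cong (y ∷ r) λ l _ →
        cong (λ b → if b then φ (s ∷ l) else 0ℚ) (sym (strictRow-< l (ℤₚ.suc[i]≤j⇒i<j x<s)))
      g′x≡0 : g′ x ≡ 0ℚ
      g′x≡0 = sumInterlacing-0 (y ∷ r) λ l _ →
        cong (λ b → if b then φ (x ∷ l) else 0ℚ) (strictRow-≮ l (ℤₚ.<-irrefl refl))

countℚ-triple : ∀ {m} (l : Vec ℤ (suc m)) → HasTriple l → countℚ l ≡ 0ℚ
countℚ-triple l@(a ∷ b ∷ c ∷ t) triple = trans (countℚ-recursion l) (sumInterlacing-0 l λ s s↑ →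
  cong (λ b → if b then countℚ s else 0ℚ) (strictRow-interlacing-triple l s s↑ triple))

extendedCount : ∀ m → Vec ℤ (suc m) → ℚ
extendedCount zero    _ = 1ℚ
extendedCount (suc m)   = rowSum weak (extendedCount m)

extendedCount-isPolynomial : ∀ m → IsPolynomial (suc m) (extendedCount m)
extendedCount-isPolynomial zero = 0 , Degree≤ᵛ-const 1 0 1ℚ
extendedCount-isPolynomial (suc m) with extendedCount-isPolynomial m
... | d , p = rowSumDegree (suc m) d , rowSum-Degree≤ᵛ weak (suc m) d p

extendedCount≡countℚ : ∀ m (k : Vec ℤ (suc m)) → Linked ℤ._≤_ k → extendedCount m k ≡ countℚ k
extendedCount≡countℚ zero    (x ∷ []) _  = refl
extendedCount≡countℚ (suc m) k        k↑ = begin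
  rowSum weak (extendedCount m) k
    ≡⟨ rowSum-weak≡sumInterlacing k (extendedCount m) k↑ vanishes ⟩
  sumInterlacing k (λ l → if strictRow l then extendedCount m l else 0ℚ)
    ≡⟨ sumInterlacing-cong k (λ l l↑ → cong (if strictRow l then_else 0ℚ) (extendedCount≡countℚ-above l l↑)) ⟩
  sumInterlacing k (λ l → if strictRow l then countℚ l else 0ℚ)
    ≡⟨ countℚ-recursion k ⟨
  countℚ k ∎
  where
    extendedCount≡countℚ-above : ∀ l → Interlaces k l → extendedCount m l ≡ countℚ l
    extendedCount≡countℚ-above l l↑ = extendedCount≡countℚ m l (interlaces-weaklyIncreasing k l k↑ l↑)
    vanishes : VanishesOnTriples k (extendedCount m)
    vanishes l l↑ triple = trans (extendedCount≡countℚ-above l l↑) (countℚ-triple l triple)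

weaklyIncreasing⇒linked : ∀ {n} (k : Vec ℤ n) → WeaklyIncreasing k → Linked ℤ._≤_ k
weaklyIncreasing⇒linked []          _  = []
weaklyIncreasing⇒linked (x ∷ [])    _  = [-]
weaklyIncreasing⇒linked (x ∷ y ∷ r) k↑ =
  k↑ Fin.zero (Fin.suc Fin.zero) z≤n
    ∷ weaklyIncreasing⇒linked (y ∷ r) (λ i j i≤j → k↑ (Fin.suc i) (Fin.suc j) (s≤s i≤j))

proposition3 : (m : ℕ) (α : Poly (suc m)) → IsAlpha α →
               (k : Vec ℤ (suc m)) → WeaklyIncreasing k →
               eval α k ≡ (+ countGTStrictAbove k) / 1
proposition3 m α α-counts k k↑ = begin
  eval α k
    ≡⟨ isPolynomial-≗-on-increasing⇒≗ (suc m) (eval-isPolynomial α) (extendedCount-isPolynomial m) agree k ⟩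
  extendedCount m k
    ≡⟨ extendedCount≡countℚ m k (weaklyIncreasing⇒linked k k↑) ⟩
  countℚ k ∎
  where
    agree : ∀ k → Linked ℤ._<_ k → eval α k ≡ extendedCount m k
    agree k k↑ = trans (α-counts k (λ i j → lookup⁺ ℤₚ.<-trans k↑))
                       (sym (extendedCount≡countℚ m k (Linked.map ℤₚ.<⇒≤ k↑)))
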